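{- Let $d\ge1$, let $p$ be a monic polynomial of degree $d$, and let \[\hat L(x)=\sum_{i=0}^d(-1)^i\frac{(d)_i^2}{d^i\, i!}x^{d-i}.\] Then $m_n(p)=\kappa_n^d(p\boxtimes_d\hat L)$ for every $n=1,\dots,d$.
   Context: For a monic polynomial $p$ of degree $d$ with roots $\lambda_1,\dots,\lambda_d$ write $p(x)=\sum_{i=0}^d(-1)^ia^p_ix^{d-i}$ ($a^p_0=1$) and $m_n(p)=\frac1d\sum_i\lambda_i^n$. $(d)_k=d(d-1)\cdots(d-k+1)$. The finite free multiplicative convolution $p\boxtimes_d q$ is the monic polynomial of degree $d$ with $a_k^{p\boxtimes_d q}=a_k^pa_k^q k!/(d)_k$. Finite free cumulants: for $1\le n\le d$, $\kappa_n^d(p)=\frac{(-d)^n}{d(n-1)!}\sum_{\pi\in P(n)}(-1)^{|\pi|}\frac{N!_\pi a_\pi^p(|\pi|-1)!}{(d)_\pi}$, where $P(n)$ is the set of set partitions of $\{1,\dots,n\}$, $|\pi|$ the number of blocks, $a^p_\pi=\prod_{V\in\pi}a^p_{|V|}$, $N!_\pi=\prod_V|V|!$, $(d)_\pi=\prod_V(d)_{|V|}$. -}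

module Defs where

open import Level using (Level)
open import Algebra.Bundles using (CommutativeRing)
open import Data.Nat using (ℕ; zero; suc; _∸_; _≤?_; _!) renaming (_+_ to _+ℕ_; _*_ to _*ℕ_; _^_ to _^ℕ_)
open import Data.Fin using (Fin) renaming (zero to fzero; suc to fsuc)
open import Data.List using (List; []; _∷_; [_]; map; concatMap; length)
open import Relation.Nullary using (yes; no)

ff : ℕ → ℕ → ℕ
ff d zero = 1
ff d (suc k) = ff d k *ℕ (d ∸ k)

-- Set partitions of {0,…,n-1} (standing for {1,…,n}); a partition is a list
-- of blocks, a block is a list of elements.  Each set partition is produced
-- exactly once: element n is either a new singleton block or added to one
-- of the existing blocks of a partition of {0,…,n-1}.
addToEach : ℕ → List (List ℕ) → List (List (List ℕ))
addToEach x [] = []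
addToEach x (B ∷ π) = ((x ∷ B) ∷ π) ∷ map (B ∷_) (addToEach x π)

extend : ℕ → List (List ℕ) → List (List (List ℕ))
extend x π = ([ x ] ∷ π) ∷ addToEach x π

setPartitions : ℕ → List (List (List ℕ))
setPartitions zero = [ [] ]
setPartitions (suc n) = concatMap (extend n) (setPartitions n)

prodBlocksℕ : (ℕ → ℕ) → List (List ℕ) → ℕ
prodBlocksℕ f [] = 1
prodBlocksℕ f (B ∷ π) = f (length B) *ℕ prodBlocksℕ f π

module _ {c ℓ : Level} (R : CommutativeRing c ℓ) where
  open CommutativeRing R hiding (zero)

  natR : ℕ → Carrier
  natR zero = 0#
  natR (suc n) = 1# + natR n

  sgn : ℕ → Carrier
  sgn zero = 1#
  sgn (suc i) = - sgn i

  pow : Carrier → ℕ → Carrier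
  pow x zero = 1#
  pow x (suc n) = x * pow x n

  sumFin : (n : ℕ) → (Fin n → Carrier) → Carrier
  sumFin zero f = 0#
  sumFin (suc n) f = f fzero + sumFin n (λ i → f (fsuc i))

  -- A polynomial is represented by its coefficient function
  -- (k ↦ coefficient of x^k).

  mulLin : Carrier → (ℕ → Carrier) → ℕ → Carrier
  mulLin c₀ q zero = - (c₀ * q zero)
  mulLin c₀ q (suc k) = q k - c₀ * q (suc k)

  prodLin : (d : ℕ) → (Fin d → Carrier) → ℕ → Carrier
  prodLin zero λs zero = 1#
  prodLin zero λs (suc k) = 0#
  prodLin (suc d) λs = mulLin (λs fzero) (prodLin d (λ i → λs (fsuc i)))

  HasRoots : (d : ℕ) → (Fin d → Carrier) → (ℕ → Carrier) → Set ℓ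
  HasRoots d λs p = ∀ k → p k ≈ prodLin d λs k

  -- a^p_i, where p(x) = Σ_i (-1)^i a^p_i x^{d-i}
  aCoeff : ℕ → (ℕ → Carrier) → ℕ → Carrier
  aCoeff d p i = sgn i * p (d ∸ i)

  -- Given inverses inv m of m+1, division by a positive natural m.
  -- (invPos 0 is a junk value; it is never used for d ≥ 1, n ≤ d.)
  module WithInv (inv : ℕ → Carrier) where

    invPos : ℕ → Carrier
    invPos m = inv (m ∸ 1)

    moment : (d : ℕ) → (Fin d → Carrier) → ℕ → Carrier
    moment d λs n = invPos d * sumFin d (λ i → pow (λs i) n)

    Lhat : ℕ → ℕ → Carrier
    Lhat d k with k ≤? d
    ... | yes _ = sgn (d ∸ k) * (natR (ff d (d ∸ k) *ℕ ff d (d ∸ k)) * invPos (d ^ℕ (d ∸ k) *ℕ ((d ∸ k) !)))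
    ... | no _ = 0#

    boxtimes : ℕ → (ℕ → Carrier) → (ℕ → Carrier) → ℕ → Carrier
    boxtimes d p q k with k ≤? d
    ... | yes _ = sgn (d ∸ k) * (aCoeff d p (d ∸ k) * aCoeff d q (d ∸ k) * natR ((d ∸ k) !) * invPos (ff d (d ∸ k)))
    ... | no _ = 0#

    aPart : ℕ → (ℕ → Carrier) → List (List ℕ) → Carrier
    aPart d p [] = 1#
    aPart d p (B ∷ π) = aCoeff d p (length B) * aPart d p π

    partTerm : ℕ → (ℕ → Carrier) → List (List ℕ) → Carrier
    partTerm d p π =
      sgn (length π) * (natR (prodBlocksℕ _! π *ℕ ((length π ∸ 1) !)) * aPart d p π
        * invPos (prodBlocksℕ (ff d) π))

    sumList : List (List (List ℕ)) → (List (List ℕ) → Carrier) → Carrier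
    sumList [] f = 0#
    sumList (π ∷ πs) f = f π + sumList πs f

    cumulant : ℕ → ℕ → (ℕ → Carrier) → Carrier
    cumulant d n p =
      sgn n * natR (d ^ℕ n) * invPos (d *ℕ ((n ∸ 1) !))
        * sumList (setPartitions n) (partTerm d p)

{-# OPTIONS --safe #-}

-- The coefficients a_b of q = p ⊠_d L̂ satisfy d^b a_b / (d)_b = e_b(λ), the elementary symmetric
-- polynomials of the roots, so d^n times the partition sum in κ_n^d(q) is the classical
-- moment-cumulant sum Σ_π (-1)^|π| (|π|-1)! Π_{V∈π} |V|! e_|V|.  That sum is the weighted count of
-- the ways to build a set partition of {1,…,n} element by element while labelling every block V by
-- a set of |V| roots: the new element either opens a block labelled by a single root λᵢ, or adds to
-- the label of an existing block a root it does not contain yet.  Weight a state with k blocks by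
-- (-1)^k (k-1)! and record how often each root is used.  Adding root i, used mᵢ times so far, then
-- weighs -k for opening a block and +1 for each of the k - mᵢ blocks without i, -mᵢ in total; so
-- only the states using a single root survive, and the sum is (-1)^n (n-1)! Σᵢ λᵢ^n.

module Submission where

open import Defs
open import Level using (Level)
open import Algebra.Bundles using (CommutativeRing)
open import Data.Bool using (if_then_else_)
open import Data.Empty using (⊥-elim)
open import Data.Fin using (Fin) renaming (zero to fzero; suc to fsuc)
open import Data.Fin.Subset using (Subset; inside; outside; ⁅_⁆) renaming (⊥ to ∅)
open import Data.List using (List; []; _∷_; [_]; map; concatMap; length; _++_)
open import Data.List.Relation.Unary.All as All using (All; []; _∷_)
open import Data.List.Relation.Unary.All.Properties using (map⁺; concat⁺)
open import Data.Nat using (ℕ; zero; suc; _≤_; _<_; z≤n; s≤s; _∸_; _!; _≤?_)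
  renaming (_+_ to _+ℕ_; _*_ to _*ℕ_; _^_ to _^ℕ_)
import Data.Nat.Properties as ℕₚ
open import Algebra.Properties.CommutativeSemigroup ℕₚ.+-commutativeSemigroup
  using () renaming (interchange to +-interchange)
open import Data.Nat.Tactic.RingSolver using (solve-∀)
open import Data.Sum using (_⊎_; inj₁; inj₂)
open import Data.Vec using (_∷_; []; lookup; _[_]≔_)
open import Data.Vec.Properties using (lookup-replicate)
open import Function using (_∘_)
open import Relation.Binary.PropositionalEquality as ≡ using (_≡_)
open import Relation.Nullary using (yes; no)

private
  variable
    ℓ₁ ℓ₂ : Level
    A : Set ℓ₁
    B : Set ℓ₂

-- Subsets of the roots and set partitions

mutual
  subsetsOfSize : (d b : ℕ) → List (Subset d)
  subsetsOfSize zero zero = [ [] ]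
  subsetsOfSize zero (suc b) = []
  subsetsOfSize (suc d) b = map (outside ∷_) (subsetsOfSize d b) ++ map (inside ∷_) (subsetsOfSizePred d b)

  subsetsOfSizePred : (d b : ℕ) → List (Subset d)
  subsetsOfSizePred d zero = []
  subsetsOfSizePred d (suc b) = subsetsOfSize d b

subsetsOfSize-zero : ∀ d → subsetsOfSize d 0 ≡ [ ∅ ]
subsetsOfSize-zero zero = ≡.refl
subsetsOfSize-zero (suc d) rewrite subsetsOfSize-zero d = ≡.refl

subsetsOfSize-empty : ∀ d b → d < b → subsetsOfSize d b ≡ []
subsetsOfSize-empty zero (suc b) _ = ≡.refl
subsetsOfSize-empty (suc d) (suc b) (s≤s d<b)
  rewrite subsetsOfSize-empty d (suc b) (ℕₚ.m≤n⇒m≤1+n d<b) | subsetsOfSize-empty d b d<b = ≡.refl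

absent present : ∀ {d} → Subset d → Fin d → ℕ
absent S i = if lookup S i then 0 else 1
present S i = if lookup S i then 1 else 0

a+[[b+e]+c]≡[a+[b+c]]+e : ∀ a b c e → a +ℕ ((b +ℕ e) +ℕ c) ≡ (a +ℕ (b +ℕ c)) +ℕ e
a+[[b+e]+c]≡[a+[b+c]]+e = solve-∀

_⊕_ : ∀ {d} → (Fin d → ℕ) → (Fin d → ℕ) → Fin d → ℕ
(m ⊕ m′) i = m i +ℕ m′ i

_·e_ : ∀ {d} → ℕ → Fin d → Fin d → ℕ
(k ·e fzero) fzero = k
(k ·e fzero) (fsuc j) = 0
(k ·e fsuc i) fzero = 0
(k ·e fsuc i) (fsuc j) = (k ·e i) j

·e-+ : ∀ {d} k (i j : Fin d) → (k ·e i) j +ℕ (1 ·e i) j ≡ (suc k ·e i) j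
·e-+ k fzero fzero = ℕₚ.+-comm k 1
·e-+ k fzero (fsuc j) = ≡.refl
·e-+ k (fsuc i) fzero = ≡.refl
·e-+ k (fsuc i) (fsuc j) = ·e-+ k i j

present-⁅⁆ : ∀ {d} (i j : Fin d) → present ⁅ i ⁆ j ≡ (1 ·e i) j
present-⁅⁆ fzero fzero = ≡.refl
present-⁅⁆ fzero (fsuc j) = ≡.cong (λ b → if b then 1 else 0) (lookup-replicate j outside)
present-⁅⁆ (fsuc i) fzero = ≡.refl
present-⁅⁆ (fsuc i) (fsuc j) = present-⁅⁆ i j

present-grow : ∀ {d} (S : Subset d) i j → absent S i ≡ 1 → present (S [ i ]≔ inside) j ≡ present S j +ℕ (1 ·e i) j
present-grow (outside ∷ S) fzero fzero _ = ≡.refl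
present-grow (inside ∷ S) fzero fzero ()
present-grow (x ∷ S) fzero (fsuc j) _ = ≡.sym (ℕₚ.+-identityʳ _)
present-grow (x ∷ S) (fsuc i) fzero _ = ≡.sym (ℕₚ.+-identityʳ _)
present-grow (x ∷ S) (fsuc i) (fsuc j) i∉S = present-grow S i j i∉S

absent+present : ∀ {d} (S : Subset d) i → absent S i +ℕ present S i ≡ 1
absent+present S i with lookup S i
... | inside = ≡.refl
... | outside = ≡.refl

absent≡0⊎absent≡1 : ∀ {d} (S : Subset d) i → absent S i ≡ 0 ⊎ absent S i ≡ 1
absent≡0⊎absent≡1 S i with lookup S i
... | inside = inj₁ ≡.refl
... | outside = inj₂ ≡.refl

size : List (List ℕ) → ℕ
size [] = 0
size (B ∷ π) = length B +ℕ size π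

size-addToEach : ∀ x π → All (λ π′ → size π′ ≡ suc (size π)) (addToEach x π)
size-addToEach x [] = []
size-addToEach x (B ∷ π) =
  ≡.refl ∷ map⁺ (All.map (λ eq → ≡.trans (≡.cong (length B +ℕ_) eq) (ℕₚ.+-suc (length B) (size π))) (size-addToEach x π))

size-setPartitions : ∀ n → All (λ π → size π ≡ n) (setPartitions n)
size-setPartitions zero = ≡.refl ∷ []
size-setPartitions (suc n) = concat⁺ (map⁺ (All.map sizes-extend (size-setPartitions n)))
  where
    sizes-extend : ∀ {π} → size π ≡ n → All (λ π′ → size π′ ≡ suc n) (extend n π)
    sizes-extend {π} size≡n = All.map (λ eq → ≡.trans eq (≡.cong suc size≡n)) (≡.refl ∷ size-addToEach n π)

length≤size : ∀ π → All (λ B → length B ≤ size π) π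
length≤size [] = []
length≤size (B ∷ π) =
  ℕₚ.m≤m+n (length B) (size π) ∷ All.map (λ le → ℕₚ.≤-trans le (ℕₚ.m≤n+m (size π) (length B))) (length≤size π)

1≤ff : ∀ {d b} → b ≤ d → 1 ≤ ff d b
1≤ff {b = zero} _ = s≤s z≤n
1≤ff {b = suc b} b<d = ℕₚ.*-mono-≤ (1≤ff (ℕₚ.<⇒≤ b<d)) (ℕₚ.m<n⇒0<n∸m b<d)

1≤prodBlocks-ff : ∀ {d} π → All (λ B → length B ≤ d) π → 1 ≤ prodBlocksℕ (ff d) π
1≤prodBlocks-ff [] [] = s≤s z≤n
1≤prodBlocks-ff (B ∷ π) (le ∷ les) = ℕₚ.*-mono-≤ (1≤ff le) (1≤prodBlocks-ff π les)

1≤^ : ∀ {d} → 1 ≤ d → ∀ b → 1 ≤ d ^ℕ b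
1≤^ {suc d} _ b = ℕₚ.m^n>0 (suc d) b

module _ {c ℓ : Level} (R : CommutativeRing c ℓ) where
  open CommutativeRing R hiding (zero)
  open import Algebra.Properties.Ring ring using (-‿distribˡ-*; -‿distribʳ-*; -‿involutive; -0#≈0#; -1*x≈-x; -‿+-comm)
  open import Algebra.Properties.Semiring.Sum semiring using (sum; sum-cong-≋; ∑-distrib-+; *-distribˡ-sum; sum-replicate-zero)
  open import Algebra.Properties.Semiring.Mult semiring using (_×_; ×-homo-+; ×1-homo-*)
  open import Algebra.Solver.Ring.NaturalCoefficients.Default commutativeSemiring
    using (solve; _:=_; _:+_; _:*_)
  open import Relation.Binary.Reasoning.Setoid setoid

  -- Finite sums

  sumOver : List A → (A → Carrier) → Carrier
  sumOver [] F = 0#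
  sumOver (x ∷ xs) F = F x + sumOver xs F

  sumOver-cong : ∀ (xs : List A) {F G : A → Carrier} → (∀ x → F x ≈ G x) → sumOver xs F ≈ sumOver xs G
  sumOver-cong [] F≈G = refl
  sumOver-cong (x ∷ xs) F≈G = +-cong (F≈G x) (sumOver-cong xs F≈G)

  sumOver-congᴬ : ∀ {xs : List A} {F G : A → Carrier} → All (λ x → F x ≈ G x) xs → sumOver xs F ≈ sumOver xs G
  sumOver-congᴬ [] = refl
  sumOver-congᴬ (F≈G ∷ F≈Gs) = +-cong F≈G (sumOver-congᴬ F≈Gs)

  sumOver-distrib-+ : ∀ (xs : List A) (F G : A → Carrier) → sumOver xs (λ x → F x + G x) ≈ sumOver xs F + sumOver xs G
  sumOver-distrib-+ [] F G = sym (+-identityˡ 0#)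
  sumOver-distrib-+ (x ∷ xs) F G = trans (+-congˡ (sumOver-distrib-+ xs F G))
    (solve 4 (λ a b u v → (a :+ b) :+ (u :+ v) := (a :+ u) :+ (b :+ v)) refl (F x) (G x) _ _)

  *-distribˡ-sumOver : ∀ (xs : List A) a (F : A → Carrier) → a * sumOver xs F ≈ sumOver xs (λ x → a * F x)
  *-distribˡ-sumOver [] a F = zeroʳ a
  *-distribˡ-sumOver (x ∷ xs) a F = trans (distribˡ a _ _) (+-congˡ (*-distribˡ-sumOver xs a F))

  sumOver-++ : ∀ (xs ys : List A) (F : A → Carrier) → sumOver (xs ++ ys) F ≈ sumOver xs F + sumOver ys F
  sumOver-++ [] ys F = sym (+-identityˡ _)
  sumOver-++ (x ∷ xs) ys F = trans (+-congˡ (sumOver-++ xs ys F)) (sym (+-assoc _ _ _))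

  sumOver-zero : ∀ (xs : List A) → sumOver xs (λ _ → 0#) ≈ 0#
  sumOver-zero [] = refl
  sumOver-zero (x ∷ xs) = trans (+-identityˡ _) (sumOver-zero xs)

  sumOver-sum-comm : ∀ (xs : List A) {n} (F : A → Fin n → Carrier) →
                     sumOver xs (λ x → sum (F x)) ≈ sum (λ i → sumOver xs (λ x → F x i))
  sumOver-sum-comm [] {n} F = sym (sum-replicate-zero n)
  sumOver-sum-comm (x ∷ xs) F = trans (+-congˡ (sumOver-sum-comm xs F)) (sym (∑-distrib-+ (F x) _))

  sumOver-map : ∀ (f : A → B) (xs : List A) (F : B → Carrier) → sumOver (map f xs) F ≈ sumOver xs (F ∘ f)
  sumOver-map f [] F = refl
  sumOver-map f (x ∷ xs) F = +-congˡ (sumOver-map f xs F)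

  sumOver-concatMap : ∀ (f : A → List B) (xs : List A) (F : B → Carrier) →
                      sumOver (concatMap f xs) F ≈ sumOver xs (λ x → sumOver (f x) F)
  sumOver-concatMap f [] F = refl
  sumOver-concatMap f (x ∷ xs) F = trans (sumOver-++ (f x) _ F) (+-congˡ (sumOver-concatMap f xs F))

  sumOver-comm : ∀ (xs : List A) (ys : List B) (F : A → B → Carrier) →
                 sumOver xs (λ x → sumOver ys (F x)) ≈ sumOver ys (λ y → sumOver xs (λ x → F x y))
  sumOver-comm [] ys F = sym (sumOver-zero ys)
  sumOver-comm (x ∷ xs) ys F =
    trans (+-congˡ (sumOver-comm xs ys F)) (sym (sumOver-distrib-+ ys (F x) _))

  sumList≈sumOver : ∀ inv πs (F : List (List ℕ) → Carrier) → WithInv.sumList R inv πs F ≈ sumOver πs F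
  sumList≈sumOver inv [] F = refl
  sumList≈sumOver inv (π ∷ πs) F = +-congˡ (sumList≈sumOver inv πs F)

  sumFin≈sum : ∀ n (f : Fin n → Carrier) → sumFin R n f ≈ sum f
  sumFin≈sum zero f = refl
  sumFin≈sum (suc n) f = +-congˡ (sumFin≈sum n (f ∘ fsuc))

  natR≈×1 : ∀ n → natR R n ≈ n × 1#
  natR≈×1 zero = refl
  natR≈×1 (suc n) = +-congˡ (natR≈×1 n)

  natR-+ : ∀ m n → natR R (m +ℕ n) ≈ natR R m + natR R n
  natR-+ m n = trans (natR≈×1 (m +ℕ n)) (trans (×-homo-+ 1# m n) (sym (+-cong (natR≈×1 m) (natR≈×1 n))))

  natR-* : ∀ m n → natR R (m *ℕ n) ≈ natR R m * natR R n
  natR-* m n = trans (natR≈×1 (m *ℕ n)) (trans (×1-homo-* m n) (sym (*-cong (natR≈×1 m) (natR≈×1 n))))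

  natR-1 : natR R 1 ≈ 1#
  natR-1 = +-identityʳ 1#

  -x*-y≈x*y : ∀ x y → (- x) * (- y) ≈ x * y
  -x*-y≈x*y x y = trans (sym (-‿distribˡ-* x (- y))) (trans (-‿cong (sym (-‿distribʳ-* x y))) (-‿involutive _))

  sgn-sq : ∀ k → sgn R k * sgn R k ≈ 1#
  sgn-sq zero = *-identityˡ 1#
  sgn-sq (suc k) = trans (-x*-y≈x*y _ _) (sgn-sq k)

  -[x+y]+x≈-y : ∀ x y → - (x + y) + x ≈ - y
  -[x+y]+x≈-y x y = begin
      - (x + y) + x        ≈⟨ +-congʳ (-‿+-comm x y) ⟨
      (- x + - y) + x      ≈⟨ solve 3 (λ u v w → (u :+ v) :+ w := v :+ (u :+ w)) refl (- x) (- y) x ⟩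
      - y + (- x + x)      ≈⟨ +-congˡ (-‿inverseˡ x) ⟩
      - y + 0#             ≈⟨ +-identityʳ _ ⟩
      - y ∎

  x-0#≈x : ∀ x → x - 0# ≈ x
  x-0#≈x x = trans (+-congˡ -0#≈0#) (+-identityʳ x)

  *-≈1 : ∀ {x y} → x ≈ 1# → y ≈ 1# → x * y ≈ 1#
  *-≈1 x≈1 y≈1 = trans (*-cong x≈1 y≈1) (*-identityˡ 1#)

  [[x*y]*z]*w≈[x*z]*[y*w] : ∀ x y z w → ((x * y) * z) * w ≈ (x * z) * (y * w)
  [[x*y]*z]*w≈[x*z]*[y*w] = solve 4 (λ x y z w → ((x :* y) :* z) :* w := (x :* z) :* (y :* w)) refl

  x*[y*z]≈y*[x*z] : ∀ x y z → x * (y * z) ≈ y * (x * z)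
  x*[y*z]≈y*[x*z] = solve 3 (λ x y z → x :* (y :* z) := y :* (x :* z)) refl

  -- Elementary symmetric polynomials

  weight : ∀ {d} → (Fin d → Carrier) → Subset d → Carrier
  weight λs [] = 1#
  weight λs (outside ∷ S) = weight (λs ∘ fsuc) S
  weight λs (inside ∷ S) = λs fzero * weight (λs ∘ fsuc) S

  weight-∅ : ∀ {d} (λs : Fin d → Carrier) → weight λs ∅ ≈ 1#
  weight-∅ {zero} λs = refl
  weight-∅ {suc d} λs = weight-∅ (λs ∘ fsuc)

  elementary : (d : ℕ) → (Fin d → Carrier) → ℕ → Carrier
  elementary d λs b = sumOver (subsetsOfSize d b) (weight λs)

  sumOver-subsetsOfSize-suc : ∀ d b (F : Subset (suc d) → Carrier) →
    sumOver (subsetsOfSize (suc d) b) F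
      ≈ sumOver (subsetsOfSize d b) (F ∘ (outside ∷_)) + sumOver (subsetsOfSizePred d b) (F ∘ (inside ∷_))
  sumOver-subsetsOfSize-suc d b F =
    trans (sumOver-++ (map (outside ∷_) (subsetsOfSize d b)) _ F)
          (+-cong (sumOver-map _ (subsetsOfSize d b) F) (sumOver-map _ (subsetsOfSizePred d b) F))

  sumOver-subsetsOfSize-zero : ∀ d (F : Subset d → Carrier) → sumOver (subsetsOfSize d 0) F ≈ F ∅
  sumOver-subsetsOfSize-zero d F =
    trans (reflexive (≡.cong (λ Ss → sumOver Ss F) (subsetsOfSize-zero d))) (+-identityʳ _)

  sumOver-subsetsOfSize-one : ∀ d (λs : Fin d → Carrier) (F : Subset d → Carrier) →
    sumOver (subsetsOfSize d 1) (λ S → weight λs S * F S) ≈ sum (λ i → λs i * F ⁅ i ⁆)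
  sumOver-subsetsOfSize-one zero λs F = refl
  sumOver-subsetsOfSize-one (suc d) λs F = begin
      sumOver (subsetsOfSize (suc d) 1) (λ S → weight λs S * F S)
        ≈⟨ sumOver-subsetsOfSize-suc d 1 _ ⟩
      sumOver (subsetsOfSize d 1) (λ S → weight λs′ S * F (outside ∷ S))
        + sumOver (subsetsOfSize d 0) (λ S → (λs fzero * weight λs′ S) * F (inside ∷ S))
        ≈⟨ +-cong (sumOver-subsetsOfSize-one d λs′ _)
                  (trans (sumOver-subsetsOfSize-zero d _) (*-congʳ (trans (*-congˡ (weight-∅ λs′)) (*-identityʳ _)))) ⟩
      sum (λ i → λs′ i * F ⁅ fsuc i ⁆) + λs fzero * F ⁅ fzero ⁆
        ≈⟨ +-comm _ _ ⟩
      sum (λ i → λs i * F ⁅ i ⁆) ∎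
    where
      λs′ : Fin d → Carrier
      λs′ = λs ∘ fsuc

  prodLin-vanishes : ∀ n (λs : Fin n → Carrier) k → n < k → prodLin R n λs k ≈ 0#
  prodLin-vanishes zero λs (suc k) _ = refl
  prodLin-vanishes (suc n) λs (suc k) (s≤s n<k) = begin
      prodLin R n λs′ k - λs fzero * prodLin R n λs′ (suc k)
        ≈⟨ +-cong (prodLin-vanishes n λs′ k n<k)
                  (-‿cong (trans (*-congˡ (prodLin-vanishes n λs′ (suc k) (ℕₚ.m≤n⇒m≤1+n n<k))) (zeroʳ _))) ⟩
      0# - 0#
        ≈⟨ x-0#≈x 0# ⟩
      0# ∎
    where
      λs′ : Fin n → Carrier
      λs′ = λs ∘ fsuc

  prodLin-monic : ∀ n (λs : Fin n → Carrier) → prodLin R n λs n ≈ 1#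
  prodLin-monic zero λs = refl
  prodLin-monic (suc n) λs = begin
      prodLin R n λs′ n - λs fzero * prodLin R n λs′ (suc n)
        ≈⟨ +-cong (prodLin-monic n λs′) (-‿cong (trans (*-congˡ (prodLin-vanishes n λs′ (suc n) ℕₚ.≤-refl)) (zeroʳ _))) ⟩
      1# - 0#
        ≈⟨ x-0#≈x 1# ⟩
      1# ∎
    where
      λs′ : Fin n → Carrier
      λs′ = λs ∘ fsuc

  elementary-vanishes : ∀ d (λs : Fin d → Carrier) b → d < b → elementary d λs b ≈ 0#
  elementary-vanishes d λs b d<b = reflexive (≡.cong (λ Ss → sumOver Ss (weight λs)) (subsetsOfSize-empty d b d<b))

  -- Vieta's formula, with the coefficient of x^k in ∏ (x - λᵢ) written for b + k = n
  elementary≈coefficient : ∀ n (λs : Fin n → Carrier) b k → b +ℕ k ≡ n →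
                           elementary n λs b ≈ sgn R b * prodLin R n λs k
  elementary≈coefficient n λs zero k ≡.refl = begin
      elementary k λs 0  ≈⟨ sumOver-subsetsOfSize-zero k _ ⟩
      weight λs ∅        ≈⟨ weight-∅ λs ⟩
      1#                 ≈⟨ prodLin-monic k λs ⟨
      prodLin R k λs k   ≈⟨ *-identityˡ _ ⟨
      1# * prodLin R k λs k ∎
  elementary≈coefficient (suc n) λs (suc b) zero ≡.refl
    rewrite ℕₚ.+-identityʳ b = begin
      sumOver (subsetsOfSize (suc b) (suc b)) (weight λs)
        ≈⟨ sumOver-subsetsOfSize-suc b (suc b) _ ⟩
      elementary b λs′ (suc b) + sumOver (subsetsOfSize b b) (λ S → l₀ * weight λs′ S)
        ≈⟨ trans (+-congʳ (elementary-vanishes b λs′ (suc b) ℕₚ.≤-refl))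
                 (trans (+-identityˡ _) (sym (*-distribˡ-sumOver (subsetsOfSize b b) l₀ _))) ⟩
      l₀ * elementary b λs′ b
        ≈⟨ *-congˡ (elementary≈coefficient b λs′ b 0 (ℕₚ.+-identityʳ b)) ⟩
      l₀ * (sgn R b * prodLin R b λs′ 0)
        ≈⟨ l₀-through-sign _ ⟩
      sgn R (suc b) * prodLin R (suc b) λs zero ∎
    where
      λs′ : Fin b → Carrier
      λs′ = λs ∘ fsuc
      l₀ : Carrier
      l₀ = λs fzero
      l₀-through-sign : ∀ x → l₀ * (sgn R b * x) ≈ (- sgn R b) * (- (l₀ * x))
      l₀-through-sign x = trans (x*[y*z]≈y*[x*z] _ _ _) (sym (-x*-y≈x*y _ _))
  elementary≈coefficient (suc n) λs (suc b) (suc k) b+k≡n = begin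
      sumOver (subsetsOfSize (suc n) (suc b)) (weight λs)
        ≈⟨ sumOver-subsetsOfSize-suc n (suc b) _ ⟩
      elementary n λs′ (suc b) + sumOver (subsetsOfSize n b) (λ S → l₀ * weight λs′ S)
        ≈⟨ +-cong (elementary≈coefficient n λs′ (suc b) k (≡.trans (≡.sym (ℕₚ.+-suc b k)) (ℕₚ.suc-injective b+k≡n)))
                  (trans (sym (*-distribˡ-sumOver (subsetsOfSize n b) l₀ _))
                         (*-congˡ (elementary≈coefficient n λs′ b (suc k) (ℕₚ.suc-injective b+k≡n)))) ⟩
      (- sgn R b) * prodLin R n λs′ k + l₀ * (sgn R b * prodLin R n λs′ (suc k))
        ≈⟨ +-congˡ (trans (x*[y*z]≈y*[x*z] _ _ _) (sym (-x*-y≈x*y _ _))) ⟩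
      (- sgn R b) * prodLin R n λs′ k + (- sgn R b) * (- (l₀ * prodLin R n λs′ (suc k)))
        ≈⟨ distribˡ _ _ _ ⟨
      sgn R (suc b) * prodLin R (suc n) λs (suc k) ∎
    where
      λs′ : Fin n → Carrier
      λs′ = λs ∘ fsuc
      l₀ : Carrier
      l₀ = λs fzero

  grow : ∀ {d} → (Fin d → Carrier) → Subset d → (Subset d → Carrier) → Carrier
  grow λs S G = sum (λ i → (natR R (absent S i) * λs i) * G (S [ i ]≔ inside))

  grow-outside : ∀ {d} (λs : Fin (suc d) → Carrier) S G →
                 grow λs (outside ∷ S) G ≈ λs fzero * G (inside ∷ S) + grow (λs ∘ fsuc) S (G ∘ (outside ∷_))
  grow-outside λs S G = +-congʳ (*-congʳ (trans (*-congʳ natR-1) (*-identityˡ _)))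

  grow-inside : ∀ {d} (λs : Fin (suc d) → Carrier) S G →
                grow λs (inside ∷ S) G ≈ grow (λs ∘ fsuc) S (G ∘ (inside ∷_))
  grow-inside λs S G = trans (+-congʳ (trans (*-congʳ (zeroˡ _)) (zeroˡ _))) (+-identityˡ _)

  -- Each (b+1)-subset arises from exactly b+1 of its b-subsets by adding one element.
  sumOver-weight-grow : ∀ d (λs : Fin d → Carrier) b (G : Subset d → Carrier) →
    sumOver (subsetsOfSize d b) (λ S → weight λs S * grow λs S G)
      ≈ natR R (suc b) * sumOver (subsetsOfSize d (suc b)) (λ T → weight λs T * G T)
  sumOver-weight-grow zero λs zero G = trans (+-identityʳ _) (trans (zeroʳ _) (sym (zeroʳ _)))
  sumOver-weight-grow zero λs (suc b) G = sym (zeroʳ _)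
  sumOver-weight-grow (suc d) λs b G = begin
      sumOver (subsetsOfSize (suc d) b) (λ S → weight λs S * grow λs S G)
        ≈⟨ sumOver-subsetsOfSize-suc d b _ ⟩
      sumOver (subsetsOfSize d b) (λ S → weight λs′ S * grow λs (outside ∷ S) G)
        + sumOver (subsetsOfSizePred d b) (λ S → (l₀ * weight λs′ S) * grow λs (inside ∷ S) G)
        ≈⟨ +-cong (trans (sumOver-cong (subsetsOfSize d b) (λ S → trans (*-congˡ (grow-outside λs S G)) (distribˡ _ _ _)))
                         (sumOver-distrib-+ (subsetsOfSize d b) _ _))
                  (trans (sumOver-cong (subsetsOfSizePred d b) (λ S → trans (*-assoc _ _ _) (*-congˡ (*-congˡ (grow-inside λs S G)))))
                         (sym (*-distribˡ-sumOver (subsetsOfSizePred d b) l₀ _))) ⟩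
      (sumOver (subsetsOfSize d b) (λ S → weight λs′ S * (l₀ * Gᵢ S))
        + sumOver (subsetsOfSize d b) (λ S → weight λs′ S * grow λs′ S Gₒ))
        + l₀ * sumOver (subsetsOfSizePred d b) (λ S → weight λs′ S * grow λs′ S Gᵢ)
        ≈⟨ +-cong (+-cong (trans (sumOver-cong (subsetsOfSize d b) (λ S → x*[y*z]≈y*[x*z] _ _ _))
                                 (sym (*-distribˡ-sumOver (subsetsOfSize d b) l₀ _)))
                          (sumOver-weight-grow d λs′ b Gₒ))
                  (*-congˡ (grow-from-pred b)) ⟩
      (l₀ * X + natR R (suc b) * Y) + l₀ * (natR R b * X)
        ≈⟨ +-congʳ (+-congʳ (*-identityˡ _)) ⟨
      (1# * (l₀ * X) + natR R (suc b) * Y) + l₀ * (natR R b * X)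
        ≈⟨ solve 5 (λ o l x n y → ((o :* (l :* x)) :+ ((o :+ n) :* y)) :+ (l :* (n :* x)) := (o :+ n) :* (y :+ (l :* x)))
                   refl 1# l₀ X (natR R b) Y ⟩
      natR R (suc b) * (Y + l₀ * X)
        ≈⟨ *-congˡ (+-congˡ (trans (*-distribˡ-sumOver (subsetsOfSize d b) l₀ _)
                                   (sumOver-cong (subsetsOfSize d b) (λ S → sym (*-assoc _ _ _))))) ⟩
      natR R (suc b) * (Y + sumOver (subsetsOfSize d b) (λ S → (l₀ * weight λs′ S) * Gᵢ S))
        ≈⟨ *-congˡ (sumOver-subsetsOfSize-suc d (suc b) _) ⟨
      natR R (suc b) * sumOver (subsetsOfSize (suc d) (suc b)) (λ T → weight λs T * G T) ∎
    where
      λs′ : Fin d → Carrier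
      λs′ = λs ∘ fsuc
      l₀ X Y : Carrier
      l₀ = λs fzero
      Gₒ Gᵢ : Subset d → Carrier
      Gₒ = G ∘ (outside ∷_)
      Gᵢ = G ∘ (inside ∷_)
      X = sumOver (subsetsOfSize d b) (λ S → weight λs′ S * Gᵢ S)
      Y = sumOver (subsetsOfSize d (suc b)) (λ T → weight λs′ T * Gₒ T)
      grow-from-pred : ∀ a → sumOver (subsetsOfSizePred d a) (λ S → weight λs′ S * grow λs′ S Gᵢ)
                              ≈ natR R a * sumOver (subsetsOfSize d a) (λ S → weight λs′ S * Gᵢ S)
      grow-from-pred zero = sym (zeroˡ _)
      grow-from-pred (suc a) = sumOver-weight-grow d λs′ a Gᵢ

  -- Building set partitions with labelled blocks

  signedFactorial : ℕ → Carrier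
  signedFactorial k = sgn R k * natR R ((k ∸ 1) !)

  signedFactorial-suc : ∀ k → signedFactorial (suc (suc k)) ≈ - (natR R (suc k) * signedFactorial (suc k))
  signedFactorial-suc k = begin
      (- sgn R (suc k)) * natR R (suc k *ℕ k !)
        ≈⟨ *-congˡ (natR-* (suc k) (k !)) ⟩
      (- sgn R (suc k)) * (natR R (suc k) * natR R (k !))
        ≈⟨ -‿distribˡ-* _ _ ⟨
      - (sgn R (suc k) * (natR R (suc k) * natR R (k !)))
        ≈⟨ -‿cong (x*[y*z]≈y*[x*z] _ _ _) ⟩
      - (natR R (suc k) * signedFactorial (suc k)) ∎

  sum-negate : ∀ {n} (f : Fin n → Carrier) → sum (λ i → - f i) ≈ - sum f
  sum-negate f = trans (sum-cong-≋ {y = λ i → - 1# * f i} (λ i → sym (-1*x≈-x (f i))))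
                       (trans (sym (*-distribˡ-sum (- 1#) f)) (-1*x≈-x _))

  sum-·e : ∀ {n} k (i : Fin n) (F : Fin n → Carrier) → sum (λ j → natR R ((k ·e i) j) * F j) ≈ natR R k * F i
  sum-·e {suc n} k fzero F = begin
      natR R k * F fzero + sum (λ j → 0# * F (fsuc j))
        ≈⟨ +-congˡ (trans (sum-cong-≋ {n} {y = λ _ → 0#} (λ j → zeroˡ _)) (sum-replicate-zero n)) ⟩
      natR R k * F fzero + 0#
        ≈⟨ +-identityʳ _ ⟩
      natR R k * F fzero ∎
  sum-·e {suc n} k (fsuc i) F = trans (+-congʳ (zeroˡ _)) (trans (+-identityˡ _) (sum-·e k i (F ∘ fsuc)))

  Extensional : ∀ {d} → ((Fin d → ℕ) → Carrier) → Set ℓ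
  Extensional h = ∀ {m m′} → (∀ i → m i ≡ m′ i) → h m ≈ h m′

  -- A state records, for each block built so far (most recent first), the set of roots attached to it.
  module Process (d : ℕ) (λs : Fin d → Carrier) where

    State : Set
    State = List (Subset d)

    openBlock : (State → Carrier) → State → Carrier
    openBlock Ψ σ = sum (λ i → λs i * Ψ (⁅ i ⁆ ∷ σ))

    growBlock : (State → Carrier) → State → Carrier
    growBlock Ψ [] = 0#
    growBlock Ψ (S ∷ σ) = grow λs S (λ T → Ψ (T ∷ σ)) + growBlock (Ψ ∘ (S ∷_)) σ

    step : (State → Carrier) → State → Carrier
    step Ψ σ = openBlock Ψ σ + growBlock Ψ σ

    run : ℕ → (State → Carrier) → Carrier
    run zero Ψ = Ψ []
    run (suc n) Ψ = run n (step Ψ)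

    -- the blocks of π are labelled by sets of roots of the same size
    labelSum : List (List ℕ) → (State → Carrier) → Carrier
    labelSum [] Ψ = Ψ []
    labelSum (B ∷ π) Ψ =
      natR R (length B !) * sumOver (subsetsOfSize d (length B)) (λ S → weight λs S * labelSum π (Ψ ∘ (S ∷_)))

    OnNonEmpty : (State → Carrier) → (State → Carrier) → Set ℓ
    OnNonEmpty Φ Φ′ = ∀ S σ → Φ (S ∷ σ) ≈ Φ′ (S ∷ σ)

    grow-cong : ∀ S {G G′ : Subset d → Carrier} → (∀ T → G T ≈ G′ T) → grow λs S G ≈ grow λs S G′
    grow-cong S G≈G′ = sum-cong-≋ {d} (λ i → *-congˡ (G≈G′ (S [ i ]≔ inside)))

    growBlock-cong : ∀ {Φ Φ′} → OnNonEmpty Φ Φ′ → ∀ σ → growBlock Φ σ ≈ growBlock Φ′ σ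
    growBlock-cong Φ≈Φ′ [] = refl
    growBlock-cong Φ≈Φ′ (S ∷ σ) =
      +-cong (grow-cong S (λ T → Φ≈Φ′ T σ)) (growBlock-cong (λ S′ σ′ → Φ≈Φ′ S (S′ ∷ σ′)) σ)

    step-cong : ∀ {Φ Φ′} → OnNonEmpty Φ Φ′ → ∀ σ → step Φ σ ≈ step Φ′ σ
    step-cong Φ≈Φ′ σ = +-cong (sum-cong-≋ {d} (λ i → *-congˡ (Φ≈Φ′ ⁅ i ⁆ σ))) (growBlock-cong Φ≈Φ′ σ)

    run-cong : ∀ n {Φ Φ′} → (∀ σ → Φ σ ≈ Φ′ σ) → run n Φ ≈ run n Φ′
    run-cong zero Φ≈Φ′ = Φ≈Φ′ []
    run-cong (suc n) Φ≈Φ′ = run-cong n (step-cong (λ S σ → Φ≈Φ′ (S ∷ σ)))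

    labelSum-+ : ∀ π Φ Φ′ → labelSum π (λ σ → Φ σ + Φ′ σ) ≈ labelSum π Φ + labelSum π Φ′
    labelSum-+ [] Φ Φ′ = refl
    labelSum-+ (B ∷ π) Φ Φ′ = begin
        nb * sumOver Ss (λ S → weight λs S * labelSum π (λ σ → Φ (S ∷ σ) + Φ′ (S ∷ σ)))
          ≈⟨ *-congˡ (sumOver-cong Ss (λ S → trans (*-congˡ (labelSum-+ π _ _)) (distribˡ _ _ _))) ⟩
        nb * sumOver Ss (λ S → weight λs S * labelSum π (Φ ∘ (S ∷_)) + weight λs S * labelSum π (Φ′ ∘ (S ∷_)))
          ≈⟨ trans (*-congˡ (sumOver-distrib-+ Ss _ _)) (distribˡ _ _ _) ⟩
        labelSum (B ∷ π) Φ + labelSum (B ∷ π) Φ′ ∎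
      where
        nb : Carrier
        nb = natR R (length B !)
        Ss : List (Subset d)
        Ss = subsetsOfSize d (length B)

    labelSum-∑ : ∀ π (a : Fin d → Carrier) (F : Fin d → State → Carrier) →
                 labelSum π (λ σ → sum (λ i → a i * F i σ)) ≈ sum (λ i → a i * labelSum π (F i))
    labelSum-∑ [] a F = refl
    labelSum-∑ (B ∷ π) a F = begin
        nb * sumOver Ss (λ S → weight λs S * labelSum π (λ σ → sum (λ i → a i * F i (S ∷ σ))))
          ≈⟨ *-congˡ (sumOver-cong Ss (λ S → trans (*-congˡ (labelSum-∑ π a (λ i σ → F i (S ∷ σ))))
                                                 (*-distribˡ-sum {d} (weight λs S) (term S)))) ⟩
        nb * sumOver Ss (λ S → sum (λ i → weight λs S * term S i))
          ≈⟨ *-congˡ (sumOver-sum-comm Ss (λ S i → weight λs S * term S i)) ⟩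
        nb * sum (λ i → sumOver Ss (λ S → weight λs S * term S i))
          ≈⟨ *-distribˡ-sum {d} nb (λ i → sumOver Ss (λ S → weight λs S * term S i)) ⟩
        sum (λ i → nb * sumOver Ss (λ S → weight λs S * term S i))
          ≈⟨ sum-cong-≋ {d} (λ i → trans (*-congˡ (trans (sumOver-cong Ss (λ S → x*[y*z]≈y*[x*z] _ _ _))
                                                     (sym (*-distribˡ-sumOver Ss (a i) _))))
                                   (x*[y*z]≈y*[x*z] _ _ _)) ⟩
        sum (λ i → a i * labelSum (B ∷ π) (F i)) ∎
      where
        nb : Carrier
        nb = natR R (length B !)
        Ss : List (Subset d)
        Ss = subsetsOfSize d (length B)
        term : Subset d → Fin d → Carrier
        term S i = a i * labelSum π (F i ∘ (S ∷_))

    labelSum-openBlock : ∀ x π Ψ → labelSum π (openBlock Ψ) ≈ labelSum ([ x ] ∷ π) Ψ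
    labelSum-openBlock x π Ψ = begin
        labelSum π (openBlock Ψ)
          ≈⟨ labelSum-∑ π λs (λ i σ → Ψ (⁅ i ⁆ ∷ σ)) ⟩
        sum (λ i → λs i * labelSum π (Ψ ∘ (⁅ i ⁆ ∷_)))
          ≈⟨ sumOver-subsetsOfSize-one d λs _ ⟨
        sumOver (subsetsOfSize d 1) (λ S → weight λs S * labelSum π (Ψ ∘ (S ∷_)))
          ≈⟨ trans (*-congʳ natR-1) (*-identityˡ _) ⟨
        labelSum ([ x ] ∷ π) Ψ ∎

    labelSum-growBlock : ∀ x π Ψ → labelSum π (growBlock Ψ) ≈ sumOver (addToEach x π) (λ π′ → labelSum π′ Ψ)
    labelSum-growBlock x [] Ψ = refl
    labelSum-growBlock x (B ∷ π) Ψ = begin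
        nb * sumOver Ss (λ S → weight λs S * labelSum π (λ σ → grow λs S (λ T → Ψ (T ∷ σ)) + growBlock (Ψ ∘ (S ∷_)) σ))
          ≈⟨ *-congˡ (sumOver-cong Ss (λ S → trans (*-congˡ (trans (labelSum-+ π _ _)
                (+-cong (labelSum-∑ π _ (λ i σ → Ψ ((S [ i ]≔ inside) ∷ σ))) (labelSum-growBlock x π (Ψ ∘ (S ∷_))))))
                (distribˡ _ _ _))) ⟩
        nb * sumOver Ss (λ S → weight λs S * grow λs S G
                               + weight λs S * sumOver (addToEach x π) (λ π′ → labelSum π′ (Ψ ∘ (S ∷_))))
          ≈⟨ trans (*-congˡ (sumOver-distrib-+ Ss _ _)) (distribˡ _ _ _) ⟩
        nb * sumOver Ss (λ S → weight λs S * grow λs S G)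
          + nb * sumOver Ss (λ S → weight λs S * sumOver (addToEach x π) (λ π′ → labelSum π′ (Ψ ∘ (S ∷_))))
          ≈⟨ +-cong grown-block other-blocks ⟩
        labelSum ((x ∷ B) ∷ π) Ψ + sumOver (map (B ∷_) (addToEach x π)) (λ π′ → labelSum π′ Ψ) ∎
      where
        b : ℕ
        b = length B
        nb : Carrier
        nb = natR R (b !)
        Ss : List (Subset d)
        Ss = subsetsOfSize d b
        G : Subset d → Carrier
        G = λ T → labelSum π (Ψ ∘ (T ∷_))
        grown-block : nb * sumOver Ss (λ S → weight λs S * grow λs S G) ≈ labelSum ((x ∷ B) ∷ π) Ψ
        grown-block = begin
            nb * sumOver Ss (λ S → weight λs S * grow λs S G)
              ≈⟨ *-congˡ (sumOver-weight-grow d λs b G) ⟩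
            nb * (natR R (suc b) * sumOver (subsetsOfSize d (suc b)) (λ T → weight λs T * G T))
              ≈⟨ trans (sym (*-assoc _ _ _)) (*-congʳ (trans (*-comm _ _) (sym (natR-* (suc b) (b !))))) ⟩
            labelSum ((x ∷ B) ∷ π) Ψ ∎
        other-blocks : nb * sumOver Ss (λ S → weight λs S * sumOver (addToEach x π) (λ π′ → labelSum π′ (Ψ ∘ (S ∷_))))
                       ≈ sumOver (map (B ∷_) (addToEach x π)) (λ π′ → labelSum π′ Ψ)
        other-blocks = begin
            nb * sumOver Ss (λ S → weight λs S * sumOver (addToEach x π) (λ π′ → labelSum π′ (Ψ ∘ (S ∷_))))
              ≈⟨ *-congˡ (trans (sumOver-cong Ss (λ S → *-distribˡ-sumOver (addToEach x π) _ _)) (sumOver-comm Ss (addToEach x π) _)) ⟩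
            nb * sumOver (addToEach x π) (λ π′ → sumOver Ss (λ S → weight λs S * labelSum π′ (Ψ ∘ (S ∷_))))
              ≈⟨ *-distribˡ-sumOver (addToEach x π) nb _ ⟩
            sumOver (addToEach x π) (λ π′ → labelSum (B ∷ π′) Ψ)
              ≈⟨ sumOver-map (B ∷_) (addToEach x π) _ ⟨
            sumOver (map (B ∷_) (addToEach x π)) (λ π′ → labelSum π′ Ψ) ∎

    run≈sumOver-labelSum : ∀ n Ψ → run n Ψ ≈ sumOver (setPartitions n) (λ π → labelSum π Ψ)
    run≈sumOver-labelSum zero Ψ = sym (+-identityʳ _)
    run≈sumOver-labelSum (suc n) Ψ = begin
        run n (step Ψ)
          ≈⟨ run≈sumOver-labelSum n (step Ψ) ⟩
        sumOver (setPartitions n) (λ π → labelSum π (step Ψ))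
          ≈⟨ sumOver-cong (setPartitions n) (λ π → trans (labelSum-+ π (openBlock Ψ) (growBlock Ψ))
                                                       (+-cong (labelSum-openBlock n π Ψ) (labelSum-growBlock n π Ψ))) ⟩
        sumOver (setPartitions n) (λ π → sumOver (extend n π) (λ π′ → labelSum π′ Ψ))
          ≈⟨ sumOver-concatMap (extend n) (setPartitions n) _ ⟨
        sumOver (setPartitions (suc n)) (λ π → labelSum π Ψ) ∎

    multiplicity : State → Fin d → ℕ
    multiplicity [] i = 0
    multiplicity (S ∷ σ) i = present S i +ℕ multiplicity σ i

    absences : State → Fin d → ℕ
    absences [] i = 0
    absences (S ∷ σ) i = absent S i +ℕ absences σ i

    absences+multiplicity : ∀ σ i → absences σ i +ℕ multiplicity σ i ≡ length σ
    absences+multiplicity [] i = ≡.refl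
    absences+multiplicity (S ∷ σ) i =
      ≡.trans (+-interchange (absent S i) _ (present S i) _) (≡.cong₂ _+ℕ_ (absent+present S i) (absences+multiplicity σ i))

    weighted : ℕ → (Fin d → ℕ) → ((Fin d → ℕ) → Carrier) → State → Carrier
    weighted L m h σ = signedFactorial (L +ℕ length σ) * h (m ⊕ multiplicity σ)

    byMultiplicity : ((Fin d → ℕ) → Carrier) → State → Carrier
    byMultiplicity = weighted 0 (λ _ → 0)

    lower : ((Fin d → ℕ) → Carrier) → (Fin d → ℕ) → Carrier
    lower h m = - sum (λ i → natR R (m i) * (λs i * h (m ⊕ (1 ·e i))))

    lower-extensional : ∀ h → Extensional h → Extensional (lower h)
    lower-extensional h ext m≡m′ =
      -‿cong (sum-cong-≋ {d} (λ i → *-cong (reflexive (≡.cong (natR R) (m≡m′ i)))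
                                            (*-congˡ (ext (λ j → ≡.cong (_+ℕ _) (m≡m′ j))))))

    natR-absent* : ∀ (S : Subset d) i {x y} → (absent S i ≡ 1 → x ≈ y) → natR R (absent S i) * x ≈ natR R (absent S i) * y
    natR-absent* S i {x} {y} x≈y with absent≡0⊎absent≡1 S i
    ... | inj₁ i∈S rewrite i∈S = trans (zeroˡ x) (sym (zeroˡ y))
    ... | inj₂ i∉S = *-congˡ (x≈y i∉S)

    growBlock-weighted : ∀ h → Extensional h → ∀ σ L m →
      growBlock (weighted L m h) σ
        ≈ sum (λ i → signedFactorial (L +ℕ length σ) * (natR R (absences σ i) * (λs i * h ((m ⊕ multiplicity σ) ⊕ (1 ·e i)))))
    growBlock-weighted h ext [] L m =
      sym (trans (sum-cong-≋ {d} {y = λ _ → 0#} (λ i → trans (*-congˡ (zeroˡ _)) (zeroʳ _))) (sum-replicate-zero d))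
    growBlock-weighted h ext (S ∷ σ) L m = begin
        grow λs S (λ T → weighted L m h (T ∷ σ)) + growBlock (weighted L m h ∘ (S ∷_)) σ
          ≈⟨ +-cong (sum-cong-≋ grown) (trans (growBlock-cong shifted σ) (growBlock-weighted h ext σ (suc L) (m ⊕ present S))) ⟩
        sum (λ i → g * (natR R (absent S i) * Y i)) + sum (λ i → g′ * (natR R (absences σ i) * Y′ i))
          ≈⟨ +-congˡ (sum-cong-≋ {d} (λ i → *-cong (reflexive (≡.cong signedFactorial (≡.sym (ℕₚ.+-suc L _))))
                                             (*-congˡ (*-congˡ (ext (λ j → ≡.cong (_+ℕ (1 ·e i) j)
                                                 (ℕₚ.+-assoc (m j) (present S j) (multiplicity σ j)))))))) ⟩
        sum (λ i → g * (natR R (absent S i) * Y i)) + sum (λ i → g * (natR R (absences σ i) * Y i))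
          ≈⟨ ∑-distrib-+ {d} _ _ ⟨
        sum (λ i → g * (natR R (absent S i) * Y i) + g * (natR R (absences σ i) * Y i))
          ≈⟨ sum-cong-≋ {d} (λ i → trans (sym (distribˡ _ _ _))
                (*-congˡ (trans (sym (distribʳ _ _ _)) (*-congʳ (sym (natR-+ (absent S i) (absences σ i))))))) ⟩
        sum (λ i → g * (natR R (absences (S ∷ σ) i) * Y i)) ∎
      where
        g g′ : Carrier
        g = signedFactorial (L +ℕ suc (length σ))
        g′ = signedFactorial (suc L +ℕ length σ)
        Y Y′ : Fin d → Carrier
        Y i = λs i * h ((m ⊕ multiplicity (S ∷ σ)) ⊕ (1 ·e i))
        Y′ i = λs i * h (((m ⊕ present S) ⊕ multiplicity σ) ⊕ (1 ·e i))
        grown : ∀ i → (natR R (absent S i) * λs i) * weighted L m h ((S [ i ]≔ inside) ∷ σ) ≈ g * (natR R (absent S i) * Y i)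
        grown i = trans (solve 4 (λ a l x y → (a :* l) :* (x :* y) := x :* (a :* (l :* y))) refl _ _ _ _)
                        (*-congˡ (natR-absent* S i (λ i∉S → *-congˡ (ext (λ j → regroup j (present-grow S i j i∉S))))))
          where
            regroup : ∀ j {p} → p ≡ present S j +ℕ (1 ·e i) j →
                      m j +ℕ (p +ℕ multiplicity σ j) ≡ (m j +ℕ (present S j +ℕ multiplicity σ j)) +ℕ (1 ·e i) j
            regroup j ≡.refl = a+[[b+e]+c]≡[a+[b+c]]+e (m j) (present S j) (multiplicity σ j) ((1 ·e i) j)
        shifted : OnNonEmpty (weighted L m h ∘ (S ∷_)) (weighted (suc L) (m ⊕ present S) h)
        shifted S′ σ′ = *-cong (reflexive (≡.cong signedFactorial (ℕₚ.+-suc L _)))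
                               (ext (λ j → ≡.sym (ℕₚ.+-assoc (m j) (present S j) (multiplicity (S′ ∷ σ′) j))))

    step-byMultiplicity : ∀ h → Extensional h → OnNonEmpty (step (byMultiplicity h)) (byMultiplicity (lower h))
    step-byMultiplicity h ext S σ = begin
        openBlock (byMultiplicity h) σ₀ + growBlock (byMultiplicity h) σ₀
          ≈⟨ +-cong (sum-cong-≋ opened) (growBlock-weighted h ext σ₀ 0 (λ _ → 0)) ⟩
        sum (λ i → g′ * X i) + sum (λ i → g * (natR R (absences σ₀ i) * X i))
          ≈⟨ ∑-distrib-+ {d} _ _ ⟨
        sum (λ i → g′ * X i + g * (natR R (absences σ₀ i) * X i))
          ≈⟨ sum-cong-≋ cancel ⟩
        sum (λ i → - (g * (natR R (multiplicity σ₀ i) * X i)))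
          ≈⟨ sum-negate {d} _ ⟩
        - sum (λ i → g * (natR R (multiplicity σ₀ i) * X i))
          ≈⟨ -‿cong (*-distribˡ-sum {d} g _) ⟨
        - (g * sum (λ i → natR R (multiplicity σ₀ i) * X i))
          ≈⟨ -‿distribʳ-* _ _ ⟩
        byMultiplicity (lower h) σ₀ ∎
      where
        σ₀ : State
        σ₀ = S ∷ σ
        g g′ : Carrier
        g = signedFactorial (length σ₀)
        g′ = signedFactorial (suc (length σ₀))
        X : Fin d → Carrier
        X i = λs i * h (multiplicity σ₀ ⊕ (1 ·e i))
        opened : ∀ i → λs i * byMultiplicity h (⁅ i ⁆ ∷ σ₀) ≈ g′ * X i
        opened i = trans (x*[y*z]≈y*[x*z] _ _ _)
          (*-congˡ (*-congˡ (ext (λ j → ≡.trans (≡.cong (_+ℕ multiplicity σ₀ j) (present-⁅⁆ i j))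
                                                (ℕₚ.+-comm ((1 ·e i) j) _)))))
        -- opening a block with root i weighs -|σ₀| g, and each of the |σ₀| - mᵢ blocks without i weighs g
        cancel : ∀ i → g′ * X i + g * (natR R (absences σ₀ i) * X i) ≈ - (g * (natR R (multiplicity σ₀ i) * X i))
        cancel i = begin
            g′ * X i + P
              ≈⟨ +-congʳ (*-congʳ (trans (signedFactorial-suc (length σ)) (-‿cong (*-congʳ length≈)))) ⟩
            (- ((Nₐ + Nₘ) * g)) * X i + P
              ≈⟨ +-congʳ (trans (sym (-‿distribˡ-* _ _))
                                (-‿cong (solve 4 (λ a m g x → ((a :+ m) :* g) :* x := g :* (a :* x) :+ g :* (m :* x))
                                                 refl Nₐ Nₘ g (X i)))) ⟩
            - (P + Q) + P
              ≈⟨ -[x+y]+x≈-y P Q ⟩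
            - Q ∎
          where
            Nₐ Nₘ P Q : Carrier
            Nₐ = natR R (absences σ₀ i)
            Nₘ = natR R (multiplicity σ₀ i)
            P = g * (Nₐ * X i)
            Q = g * (Nₘ * X i)
            length≈ : natR R (length σ₀) ≈ Nₐ + Nₘ
            length≈ = trans (reflexive (≡.cong (natR R) (≡.sym (absences+multiplicity σ₀ i))))
                            (natR-+ (absences σ₀ i) (multiplicity σ₀ i))

    run-byMultiplicity : ∀ n h → Extensional h →
      run (suc n) (byMultiplicity h) ≈ signedFactorial (suc n) * sum (λ i → pow R (λs i) (suc n) * h (suc n ·e i))
    run-byMultiplicity zero h ext = begin
        sum (λ i → λs i * byMultiplicity h [ ⁅ i ⁆ ]) + 0#
          ≈⟨ +-identityʳ _ ⟩
        sum (λ i → λs i * (signedFactorial 1 * h (multiplicity [ ⁅ i ⁆ ])))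
          ≈⟨ sum-cong-≋ {d} (λ i → trans (x*[y*z]≈y*[x*z] _ _ _)
                (*-congˡ (*-cong (sym (*-identityʳ _)) (ext (λ j → ≡.trans (ℕₚ.+-identityʳ _) (present-⁅⁆ i j)))))) ⟩
        sum (λ i → signedFactorial 1 * ((λs i * 1#) * h (1 ·e i)))
          ≈⟨ *-distribˡ-sum {d} _ _ ⟨
        signedFactorial 1 * sum (λ i → pow R (λs i) 1 * h (1 ·e i)) ∎
    run-byMultiplicity (suc n) h ext = begin
        run (suc n) (step (byMultiplicity h))
          ≈⟨ run-cong n (step-cong (step-byMultiplicity h ext)) ⟩
        run (suc n) (byMultiplicity (lower h))
          ≈⟨ run-byMultiplicity n (lower h) (lower-extensional h ext) ⟩
        g * sum (λ i → pow R (λs i) (suc n) * lower h (suc n ·e i))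
          ≈⟨ *-congˡ (trans (sum-cong-≋ lowered) (sum-negate {d} _)) ⟩
        g * (- sum (λ i → N * P i))
          ≈⟨ *-congˡ (-‿cong (*-distribˡ-sum {d} N P)) ⟨
        g * (- (N * sum P))
          ≈⟨ trans (sym (-‿distribʳ-* _ _)) (trans (-‿cong (sym (*-assoc _ _ _))) (-‿distribˡ-* _ _)) ⟩
        (- (g * N)) * sum P
          ≈⟨ *-congʳ (trans (-‿cong (*-comm g N)) (sym (signedFactorial-suc n))) ⟩
        signedFactorial (suc (suc n)) * sum P ∎
      where
        g N : Carrier
        g = signedFactorial (suc n)
        N = natR R (suc n)
        P : Fin d → Carrier
        P i = pow R (λs i) (suc (suc n)) * h (suc (suc n) ·e i)
        lowered : ∀ i → pow R (λs i) (suc n) * lower h (suc n ·e i) ≈ - (N * P i)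
        lowered i = begin
            pow R (λs i) (suc n) * lower h (suc n ·e i)
              ≈⟨ *-congˡ (-‿cong (sum-·e (suc n) i _)) ⟩
            pow R (λs i) (suc n) * (- (N * (λs i * h ((suc n ·e i) ⊕ (1 ·e i)))))
              ≈⟨ *-congˡ (-‿cong (*-congˡ (*-congˡ (ext (·e-+ (suc n) i))))) ⟩
            pow R (λs i) (suc n) * (- (N * (λs i * h (suc (suc n) ·e i))))
              ≈⟨ -‿distribʳ-* _ _ ⟨
            - (pow R (λs i) (suc n) * (N * (λs i * h (suc (suc n) ·e i))))
              ≈⟨ -‿cong (solve 4 (λ p n l x → p :* (n :* (l :* x)) := n :* ((l :* p) :* x)) refl _ N _ _) ⟩
            - (N * P i) ∎

    elementaryProduct : List (List ℕ) → Carrier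
    elementaryProduct [] = 1#
    elementaryProduct (B ∷ π) = elementary d λs (length B) * elementaryProduct π

    labelSum-length : ∀ π (φ : ℕ → Carrier) →
      labelSum π (φ ∘ length) ≈ φ (length π) * (natR R (prodBlocksℕ _! π) * elementaryProduct π)
    labelSum-length [] φ = sym (trans (*-congˡ (trans (*-congʳ natR-1) (*-identityˡ _))) (*-identityʳ _))
    labelSum-length (B ∷ π) φ = begin
        nb * sumOver Ss (λ S → weight λs S * labelSum π ((φ ∘ suc) ∘ length))
          ≈⟨ *-congˡ (sumOver-cong Ss (λ S → trans (*-congˡ (labelSum-length π (φ ∘ suc))) (*-comm _ _))) ⟩
        nb * sumOver Ss (λ S → C * weight λs S)
          ≈⟨ *-congˡ (*-distribˡ-sumOver Ss C (weight λs)) ⟨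
        nb * (C * elementary d λs (length B))
          ≈⟨ solve 5 (λ n f p e E → n :* ((f :* (p :* E)) :* e) := f :* ((n :* p) :* (e :* E))) refl nb _ _ _ _ ⟩
        φ (suc (length π)) * ((nb * natR R (prodBlocksℕ _! π)) * elementaryProduct (B ∷ π))
          ≈⟨ *-congˡ (*-congʳ (natR-* (length B !) (prodBlocksℕ _! π))) ⟨
        φ (length (B ∷ π)) * (natR R (prodBlocksℕ _! (B ∷ π)) * elementaryProduct (B ∷ π)) ∎
      where
        nb C : Carrier
        nb = natR R (length B !)
        Ss : List (Subset d)
        Ss = subsetsOfSize d (length B)
        C = φ (suc (length π)) * (natR R (prodBlocksℕ _! π) * elementaryProduct π)

    -- Newton's identities in set-partition form
    sumOver-partitions≈powerSum : ∀ n →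
      sumOver (setPartitions (suc n)) (λ π → signedFactorial (length π) * (natR R (prodBlocksℕ _! π) * elementaryProduct π))
        ≈ signedFactorial (suc n) * sum (λ i → pow R (λs i) (suc n))
    sumOver-partitions≈powerSum n = begin
        sumOver (setPartitions (suc n)) (λ π → signedFactorial (length π) * (natR R (prodBlocksℕ _! π) * elementaryProduct π))
          ≈⟨ sumOver-cong (setPartitions (suc n))
               (λ π → trans (labelSum-length π (λ k → signedFactorial k * 1#)) (*-congʳ (*-identityʳ _))) ⟨
        sumOver (setPartitions (suc n)) (λ π → labelSum π (byMultiplicity (λ _ → 1#)))
          ≈⟨ run≈sumOver-labelSum (suc n) _ ⟨
        run (suc n) (byMultiplicity (λ _ → 1#))
          ≈⟨ run-byMultiplicity n (λ _ → 1#) (λ _ → refl) ⟩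
        signedFactorial (suc n) * sum (λ i → pow R (λs i) (suc n) * 1#)
          ≈⟨ *-congˡ (sum-cong-≋ {d} (λ i → *-identityʳ _)) ⟩
        signedFactorial (suc n) * sum (λ i → pow R (λs i) (suc n)) ∎

  -- The coefficients of p ⊠_d L̂

  module Inverses (inv : ℕ → Carrier) (inv-correct : ∀ m → natR R (suc m) * inv m ≈ 1#) where
    open WithInv R inv

    *-invPos : ∀ {m} → 1 ≤ m → natR R m * invPos m ≈ 1#
    *-invPos {suc m} _ = inv-correct m

    invPos-unique : ∀ {m} y → 1 ≤ m → natR R m * y ≈ 1# → invPos m ≈ y
    invPos-unique {m} y 1≤m m*y≈1 = begin
        invPos m                    ≈⟨ *-identityʳ _ ⟨
        invPos m * 1#               ≈⟨ *-congˡ m*y≈1 ⟨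
        invPos m * (natR R m * y)   ≈⟨ *-assoc _ _ _ ⟨
        (invPos m * natR R m) * y   ≈⟨ *-congʳ (trans (*-comm _ _) (*-invPos 1≤m)) ⟩
        1# * y                      ≈⟨ *-identityˡ y ⟩
        y ∎

    invPos-* : ∀ {a b} → 1 ≤ a → 1 ≤ b → invPos (a *ℕ b) ≈ invPos a * invPos b
    invPos-* {a} {b} 1≤a 1≤b = invPos-unique _ (ℕₚ.*-mono-≤ 1≤a 1≤b) (begin
        natR R (a *ℕ b) * (invPos a * invPos b)
          ≈⟨ *-congʳ (natR-* a b) ⟩
        (natR R a * natR R b) * (invPos a * invPos b)
          ≈⟨ solve 4 (λ x y u v → (x :* y) :* (u :* v) := (x :* u) :* (y :* v)) refl _ _ _ _ ⟩
        (natR R a * invPos a) * (natR R b * invPos b)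
          ≈⟨ *-≈1 (*-invPos 1≤a) (*-invPos 1≤b) ⟩
        1# ∎)

    normalisation*signedFactorial : ∀ {d} n x → 1 ≤ d →
      (sgn R (suc n) * invPos (d *ℕ n !)) * (signedFactorial (suc n) * x) ≈ invPos d * x
    normalisation*signedFactorial {d} n x 1≤d = begin
        (s * invPos (d *ℕ n !)) * ((s * natR R (n !)) * x)
          ≈⟨ *-congʳ (*-congˡ (invPos-* 1≤d (ℕₚ.1≤n! n))) ⟩
        (s * (invPos d * invPos (n !))) * ((s * natR R (n !)) * x)
          ≈⟨ solve 5 (λ s a b c x → (s :* (a :* b)) :* ((s :* c) :* x) := ((s :* s) :* (c :* b)) :* (a :* x)) refl s _ _ _ x ⟩
        ((s * s) * (natR R (n !) * invPos (n !))) * (invPos d * x)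
          ≈⟨ trans (*-congʳ (*-≈1 (sgn-sq (suc n)) (*-invPos (ℕₚ.1≤n! n)))) (*-identityˡ _) ⟩
        invPos d * x ∎
      where
        s : Carrier
        s = sgn R (suc n)

  module Coefficients (inv : ℕ → Carrier) (inv-correct : ∀ m → natR R (suc m) * inv m ≈ 1#)
                      (d : ℕ) (1≤d : 1 ≤ d) (p : ℕ → Carrier) (λs : Fin d → Carrier) (roots : HasRoots R d λs p) where
    open WithInv R inv
    open Inverses inv inv-correct
    open Process d λs

    Lhat-coefficient : ∀ {b} → b ≤ d → Lhat d (d ∸ b) ≡ sgn R b * (natR R (ff d b *ℕ ff d b) * invPos (d ^ℕ b *ℕ b !))
    Lhat-coefficient {b} b≤d with d ∸ b ≤? d
    ... | no d∸b≰d = ⊥-elim (d∸b≰d (ℕₚ.m∸n≤m d b))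
    ... | yes _ rewrite ℕₚ.m∸[m∸n]≡n b≤d = ≡.refl

    boxtimes-coefficient : ∀ f g {b} → b ≤ d →
      boxtimes d f g (d ∸ b) ≡ sgn R b * (aCoeff R d f b * aCoeff R d g b * natR R (b !) * invPos (ff d b))
    boxtimes-coefficient f g {b} b≤d with d ∸ b ≤? d
    ... | no d∸b≰d = ⊥-elim (d∸b≰d (ℕₚ.m∸n≤m d b))
    ... | yes _ rewrite ℕₚ.m∸[m∸n]≡n b≤d = ≡.refl

    aCoeff≈elementary : ∀ {b} → b ≤ d → aCoeff R d p b ≈ elementary d λs b
    aCoeff≈elementary {b} b≤d =
      trans (*-congˡ (roots (d ∸ b))) (sym (elementary≈coefficient d λs b (d ∸ b) (ℕₚ.m+[n∸m]≡n b≤d)))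

    q : ℕ → Carrier
    q = boxtimes d p (Lhat d)

    -- a^q_b = a^p_b (d)_b / d^b, and a^p_b is the elementary symmetric polynomial e_b
    scaled-aCoeff-q : ∀ {b} → b ≤ d → natR R (d ^ℕ b) * (aCoeff R d q b * invPos (ff d b)) ≈ elementary d λs b
    scaled-aCoeff-q {b} b≤d = begin
        nD * ((s * q (d ∸ b)) * iF)
          ≈⟨ *-congˡ (*-congʳ (*-congˡ (reflexive (boxtimes-coefficient p (Lhat d) b≤d)))) ⟩
        nD * ((s * (s * (((aP * (s * Lhat d (d ∸ b))) * nb) * iF))) * iF)
          ≈⟨ *-congˡ (*-congʳ (*-congˡ (*-congˡ (*-congʳ (*-congʳ (*-congˡ (*-congˡ (trans (reflexive (Lhat-coefficient b≤d))
                (*-congˡ (*-cong (natR-* (ff d b) (ff d b)) (invPos-* (1≤^ 1≤d b) (ℕₚ.1≤n! b)))))))))))) ⟩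
        nD * ((s * (s * (((aP * (s * (s * ((nF * nF) * (iD * ib))))) * nb) * iF))) * iF)
          ≈⟨ solve 8 (λ s aP nF iD ib nb iF nD →
                nD :* ((s :* (s :* (((aP :* (s :* (s :* ((nF :* nF) :* (iD :* ib))))) :* nb) :* iF))) :* iF)
                := aP :* (((s :* s) :* (s :* s)) :* ((nD :* iD) :* ((nb :* ib) :* ((nF :* iF) :* (nF :* iF))))))
                refl s aP nF iD ib nb iF nD ⟩
        aP * (((s * s) * (s * s)) * ((nD * iD) * ((nb * ib) * ((nF * iF) * (nF * iF)))))
          ≈⟨ *-congˡ (*-≈1 (*-≈1 (sgn-sq b) (sgn-sq b))
                           (*-≈1 (*-invPos (1≤^ 1≤d b)) (*-≈1 (*-invPos (ℕₚ.1≤n! b)) (*-≈1 F≈1 F≈1)))) ⟩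
        aP * 1#
          ≈⟨ *-identityʳ aP ⟩
        aP
          ≈⟨ aCoeff≈elementary b≤d ⟩
        elementary d λs b ∎
      where
        s aP nb ib nF iF nD iD : Carrier
        s = sgn R b
        aP = aCoeff R d p b
        nb = natR R (b !)
        ib = invPos (b !)
        nF = natR R (ff d b)
        iF = invPos (ff d b)
        nD = natR R (d ^ℕ b)
        iD = invPos (d ^ℕ b)
        F≈1 : nF * iF ≈ 1#
        F≈1 = *-invPos (1≤ff b≤d)

    scaled-aPart-q : ∀ π → All (λ B → length B ≤ d) π →
      natR R (d ^ℕ size π) * (aPart d q π * invPos (prodBlocksℕ (ff d) π)) ≈ elementaryProduct π
    scaled-aPart-q [] [] = trans (*-congˡ (*-identityˡ _)) (*-invPos (s≤s z≤n))
    scaled-aPart-q (B ∷ π) (b≤d ∷ bs≤d) = begin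
        natR R (d ^ℕ (b +ℕ size π)) * ((aCoeff R d q b * aPart d q π) * invPos (ff d b *ℕ prodBlocksℕ (ff d) π))
          ≈⟨ *-cong (trans (reflexive (≡.cong (natR R) (ℕₚ.^-distribˡ-+-* d b (size π)))) (natR-* (d ^ℕ b) (d ^ℕ size π)))
                    (*-congˡ (invPos-* (1≤ff b≤d) (1≤prodBlocks-ff π bs≤d))) ⟩
        (natR R (d ^ℕ b) * natR R (d ^ℕ size π)) * ((aCoeff R d q b * aPart d q π) * (invPos (ff d b) * invPos (prodBlocksℕ (ff d) π)))
          ≈⟨ solve 6 (λ x y a A u v → (x :* y) :* ((a :* A) :* (u :* v)) := (x :* (a :* u)) :* (y :* (A :* v))) refl _ _ _ _ _ _ ⟩
        (natR R (d ^ℕ b) * (aCoeff R d q b * invPos (ff d b))) * (natR R (d ^ℕ size π) * (aPart d q π * invPos (prodBlocksℕ (ff d) π)))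
          ≈⟨ *-cong (scaled-aCoeff-q b≤d) (scaled-aPart-q π bs≤d) ⟩
        elementaryProduct (B ∷ π) ∎
      where
        b : ℕ
        b = length B

    scaled-partTerm-q : ∀ {n} π → size π ≡ n → n ≤ d →
      natR R (d ^ℕ n) * partTerm d q π ≈ signedFactorial (length π) * (natR R (prodBlocksℕ _! π) * elementaryProduct π)
    scaled-partTerm-q π ≡.refl n≤d = begin
        nD * (s * ((natR R (prodBlocksℕ _! π *ℕ (length π ∸ 1) !) * aπ) * iPB))
          ≈⟨ *-congˡ (*-congˡ (*-congʳ (*-congʳ (natR-* (prodBlocksℕ _! π) ((length π ∸ 1) !))))) ⟩
        nD * (s * (((nNF * nLF) * aπ) * iPB))
          ≈⟨ solve 6 (λ x s a b A i → x :* (s :* (((a :* b) :* A) :* i)) := (s :* b) :* (a :* (x :* (A :* i)))) refl _ _ _ _ _ _ ⟩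
        (s * nLF) * (nNF * (nD * (aπ * iPB)))
          ≈⟨ *-congˡ (*-congˡ (scaled-aPart-q π (All.map (λ le → ℕₚ.≤-trans le n≤d) (length≤size π)))) ⟩
        signedFactorial (length π) * (nNF * elementaryProduct π) ∎
      where
        nD s aπ iPB nNF nLF : Carrier
        nD = natR R (d ^ℕ size π)
        s = sgn R (length π)
        aπ = aPart d q π
        iPB = invPos (prodBlocksℕ (ff d) π)
        nNF = natR R (prodBlocksℕ _! π)
        nLF = natR R ((length π ∸ 1) !)

lemma3p2 : {c ℓ : Level} (R : CommutativeRing c ℓ)
    → (inv : ℕ → CommutativeRing.Carrier R)
    → (∀ m → CommutativeRing._≈_ R (CommutativeRing._*_ R (natR R (suc m)) (inv m)) (CommutativeRing.1# R))
    → (d : ℕ) → 1 ≤ d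
    → (p : ℕ → CommutativeRing.Carrier R)
    → (λs : Fin d → CommutativeRing.Carrier R)
    → HasRoots R d λs p
    → (n : ℕ) → 1 ≤ n → n ≤ d
    → CommutativeRing._≈_ R (WithInv.moment R inv d λs n)
    (WithInv.cumulant R inv d n (WithInv.boxtimes R inv d p (WithInv.Lhat R inv d)))
lemma3p2 R inv inv-correct d 1≤d p λs roots (suc n) _ n<d = sym (begin
    ((sgn R (suc n) * natR R (d ^ℕ suc n)) * invPos (d *ℕ n !)) * sumList Πs (partTerm d q)
      ≈⟨ *-congˡ (sumList≈sumOver R inv Πs (partTerm d q)) ⟩
    ((sgn R (suc n) * natR R (d ^ℕ suc n)) * invPos (d *ℕ n !)) * sumOver R Πs (partTerm d q)
      ≈⟨ trans ([[x*y]*z]*w≈[x*z]*[y*w] R _ _ _ _) (*-congˡ (*-distribˡ-sumOver R Πs _ (partTerm d q))) ⟩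
    scale * sumOver R Πs (λ π → natR R (d ^ℕ suc n) * partTerm d q π)
      ≈⟨ *-congˡ (sumOver-congᴬ R (All.map (λ {π} size≡ → scaled-partTerm-q π size≡ n<d) (size-setPartitions (suc n)))) ⟩
    scale * sumOver R Πs (λ π → signedFactorial R (length π) * (natR R (prodBlocksℕ _! π) * elementaryProduct π))
      ≈⟨ *-congˡ (sumOver-partitions≈powerSum n) ⟩
    scale * (signedFactorial R (suc n) * powerSum)
      ≈⟨ normalisation*signedFactorial n powerSum 1≤d ⟩
    invPos d * powerSum
      ≈⟨ *-congˡ (sumFin≈sum R d _) ⟨
    moment d λs (suc n) ∎)
  where
    open CommutativeRing R
    open WithInv R inv
    open Inverses R inv inv-correct
    open Coefficients R inv inv-correct d 1≤d p λs roots
    open Process R d λs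
    open import Algebra.Properties.Semiring.Sum semiring using (sum)
    open import Relation.Binary.Reasoning.Setoid setoid
    Πs : List (List (List ℕ))
    Πs = setPartitions (suc n)
    scale powerSum : Carrier
    scale = sgn R (suc n) * invPos (d *ℕ n !)
    powerSum = sum (λ i → pow R (λs i) (suc n))
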